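{- Let $G$ be any graph and $k$ a positive integer. If $\mathbf{vsrc}(G)\le k$, then $G$ is $k$-perfectly groupable.
   Context: All graphs are finite, simple and undirected. A graph is $k$-perfectly groupable if the neighborhood of each vertex can be partitioned into at most $k$ cliques. A very strong rainbow coloring of $G$ is a coloring of $E(G)$ such that for every pair of vertices and every shortest path between them, all edges of that path receive pairwise different colors; $\mathbf{vsrc}(G)$ is the minimum number of colors in such a coloring. -}

module Defs where

open import Data.Nat using (ℕ; zero; suc; _≤_)
open import Data.Fin using (Fin)
open import Data.Bool using (Bool; true; false)
open import Data.List using (List; []; _∷_)
open import Data.List.Relation.Unary.Unique.Propositional using (Unique)
open import Data.Product using (Σ; ∃; _×_; _,_)
open import Relation.Binary.PropositionalEquality using (_≡_)
open import Relation.Nullary using (¬_)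

record Graph : Set where
  field
    n      : ℕ
    adj    : Fin n → Fin n → Bool
    sym    : ∀ u v → adj u v ≡ adj v u
    irrefl : ∀ v → adj v v ≡ false

open Graph public

data Walk (G : Graph) : Fin (n G) → Fin (n G) → ℕ → Set where
  nil  : ∀ {u} → Walk G u u zero
  cons : ∀ {u w v ℓ} → adj G u w ≡ true → Walk G w v ℓ → Walk G u v (suc ℓ)

IsShortest : (G : Graph) → Fin (n G) → Fin (n G) → ℕ → Set
IsShortest G u v ℓ = ∀ ℓ' → Walk G u v ℓ' → ℓ ≤ ℓ'

-- An edge colouring with colours in Fin k: a colour for every ordered pair,
-- required to be symmetric on edges (so it is a colouring of E(G)).
record EdgeColoring (G : Graph) (k : ℕ) : Set where
  field
    col     : Fin (n G) → Fin (n G) → Fin k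
    col-sym : ∀ u v → adj G u v ≡ true → col u v ≡ col v u

open EdgeColoring public

walkColors : ∀ {G k u v ℓ} → EdgeColoring G k → Walk G u v ℓ → List (Fin k)
walkColors c nil = []
walkColors {u = u} c (cons {w = w} _ p) = col c u w ∷ walkColors c p

VeryStrongRainbow : ∀ {G k} → EdgeColoring G k → Set
VeryStrongRainbow {G} c =
  ∀ (u v : Fin (n G)) (ℓ : ℕ) (p : Walk G u v ℓ) →
    IsShortest G u v ℓ → Unique (walkColors c p)

-- vsrc(G) ≤ k  ⇔  there is a very strong rainbow colouring using at most k colours
-- (colours drawn from Fin k).
VsrcAtMost : Graph → ℕ → Set
VsrcAtMost G k = Σ (EdgeColoring G k) VeryStrongRainbow

-- k-perfectly groupable: the neighbourhood of every vertex can be partitioned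
-- into at most k cliques (classes indexed by Fin k, empty classes allowed).
PerfectlyGroupable : ℕ → Graph → Set
PerfectlyGroupable k G =
  ∀ (v : Fin (n G)) →
    Σ ((w : Fin (n G)) → adj G v w ≡ true → Fin k) λ f →
      ∀ w w' (h : adj G v w ≡ true) (h' : adj G v w' ≡ true) →
        f w h ≡ f w' h' → ¬ (w ≡ w') → adj G w w' ≡ true

module Submission where

open import Defs
open import Data.Nat using (ℕ; _≤_; zero; suc; s≤s; z≤n)
open import Data.Fin using (Fin)
open import Data.Bool using (true; false)
open import Data.Product using (_,_)
open import Data.List.Relation.Unary.AllPairs using (_∷_)
open import Data.List.Relation.Unary.All using (_∷_)
open import Relation.Binary.PropositionalEquality as ≡ using (_≡_; refl; trans)
open import Relation.Nullary using (¬_)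
open import Relation.Nullary.Negation using (contradiction)

-- If vsrc(G) ≤ k, colour each edge vw by its colour: two neighbours w, w' of v in the
-- same class that were not adjacent would be at distance two, so w v w' would be a
-- shortest path with a repeated colour.

distinct-nonadjacent⇒distance-two : (G : Graph) {w w' : Fin (n G)} →
  ¬ (w ≡ w') → adj G w w' ≡ false → IsShortest G w w' 2
distinct-nonadjacent⇒distance-two G w≢w' _ zero nil = contradiction refl w≢w'
distinct-nonadjacent⇒distance-two G _ w≁w' (suc zero) (cons w∼w' nil)
  with () ← trans (≡.sym w∼w') w≁w'
distinct-nonadjacent⇒distance-two G _ _ (suc (suc ℓ)) _ = s≤s (s≤s z≤n)

walk-through : (G : Graph) {v w w' : Fin (n G)} →
  adj G v w ≡ true → adj G v w' ≡ true → Walk G w w' 2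
walk-through G {v} {w} v∼w v∼w' = cons (trans (Graph.sym G w v) v∼w) (cons v∼w' nil)

veryStrongRainbow⇒sameColour⇒adjacent : ∀ {G k} (c : EdgeColoring G k) →
  VeryStrongRainbow c → ∀ {v w w'} (v∼w : adj G v w ≡ true) → adj G v w' ≡ true →
  col c v w ≡ col c v w' → ¬ (w ≡ w') → adj G w w' ≡ true
veryStrongRainbow⇒sameColour⇒adjacent {G} c rainbow {v} {w} {w'} v∼w v∼w' same w≢w'
  with adj G w w' in w∼w'
... | true = refl
... | false
  with (distinct ∷ _) ∷ _ ←
         rainbow w w' 2 (walk-through G v∼w v∼w')
                 (distinct-nonadjacent⇒distance-two G w≢w' w∼w')
  = contradiction (trans (≡.sym (col-sym c v w v∼w)) same) distinct

lemma4 : (G : Graph) (k : ℕ) → 1 ≤ k → VsrcAtMost G k → PerfectlyGroupable k G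
lemma4 G k _ (c , rainbow) v =
  (λ w _ → col c v w) ,
  λ _ _ v∼w v∼w' → veryStrongRainbow⇒sameColour⇒adjacent c rainbow v∼w v∼w'
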